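{- Let $G$ be a C0P-graph with partition $(C_1,C_2,U)$ (with respect to a fixed vertex ordering as in the context), and let $k$ be a positive integer. If $|C_1|\geq k$ and $|C_2|\geq k$, then $\gamma_{\times k}(G)\leq 2k$.
   Context: For a graph $G$ with vertices $v_1,\dots,v_n$, the augmented adjacency matrix $M^*(G)=(m^*_{ij})$ has $m^*_{ij}=1$ if $i=j$ or $v_iv_j\in E(G)$, and $0$ otherwise. $G$ is a C0P-graph if its vertices can be ordered $v_1,\dots,v_n$ so that in every column of $M^*(G)$ the $0$ entries occur in consecutive rows. Fix such an ordering. Since diagonal entries are $1$, the zeros of column $j$ lie either all below the diagonal (rows $i>j$) or all above (rows $i<j$). Let $C_1$ be the set of $v_j$ whose column has zeros, all below the diagonal; $C_2$ the set of $v_j$ whose column has zeros, all above the diagonal; and $U$ the set of $v_j$ whose column has no zeros (the universal vertices). A set $D\subseteq V(G)$ is a $k$-tuple dominating set if $|N_G[v]\cap D|\ge k$ for all $v$, where $N_G[v]$ is the closed neighborhood; $\gamma_{\times k}(G)$ is the minimum size of such a set ($+\infty$ if none exists). -}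

module Defs where

open import Data.Nat using (ℕ; _≤_; _<_)
open import Data.Bool using (Bool; true; false; _∧_; _∨_; not; T)
open import Data.Fin using (Fin; toℕ)
open import Data.Fin.Subset using (Subset; _∩_; ∣_∣; _∈_)
open import Data.Vec using (tabulate)
open import Data.List using (allFin)
open import Data.Bool.ListAction using (all; any)
open import Data.Product using (Σ; _×_)
open import Relation.Binary.PropositionalEquality using (_≡_)
open import Relation.Nullary.Decidable using (⌊_⌋)
import Data.Fin.Properties as FinP
import Data.Nat.Properties as NatP

-- A finite simple graph on the vertex set Fin n; the vertex ordering
-- v_1,...,v_n is the natural order of Fin n.
record Graph (n : ℕ) : Set where
  field
    adj     : Fin n → Fin n → Bool
    adj-sym : ∀ i j → adj i j ≡ adj j i
    adj-irr : ∀ i → adj i i ≡ false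
open Graph public

M* : ∀ {n} → Graph n → Fin n → Fin n → Bool
M* G i j = ⌊ i FinP.≟ j ⌋ ∨ adj G i j

isZero : ∀ {n} → Graph n → Fin n → Fin n → Bool
isZero G i j = not (M* G i j)

-- the natural ordering of Fin n makes G a C0P-graph: in every column of M*(G)
-- the 0 entries occur in consecutive rows
IsC0POrdering : ∀ {n} → Graph n → Set
IsC0POrdering {n} G = ∀ (j i₁ i₂ i₃ : Fin n) →
  toℕ i₁ ≤ toℕ i₂ → toℕ i₂ ≤ toℕ i₃ →
  T (isZero G i₁ j) → T (isZero G i₃ j) → T (isZero G i₂ j)

hasZero : ∀ {n} → Graph n → Fin n → Bool
hasZero G j = any (λ i → isZero G i j) (allFin _)

zerosBelow : ∀ {n} → Graph n → Fin n → Bool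
zerosBelow G j = all (λ i → not (isZero G i j) ∨ ⌊ toℕ j NatP.<? toℕ i ⌋) (allFin _)

zerosAbove : ∀ {n} → Graph n → Fin n → Bool
zerosAbove G j = all (λ i → not (isZero G i j) ∨ ⌊ toℕ i NatP.<? toℕ j ⌋) (allFin _)

C₁ : ∀ {n} → Graph n → Subset n
C₁ G = tabulate (λ j → hasZero G j ∧ zerosBelow G j)

C₂ : ∀ {n} → Graph n → Subset n
C₂ G = tabulate (λ j → hasZero G j ∧ zerosAbove G j)

U : ∀ {n} → Graph n → Subset n
U G = tabulate (λ j → not (hasZero G j))

N[_] : ∀ {n} → Graph n → Fin n → Subset n
N[ G ] v = tabulate (λ u → M* G u v)

IsKTupleDominating : ∀ {n} → Graph n → ℕ → Subset n → Set
IsKTupleDominating {n} G k D = ∀ (v : Fin n) → k ≤ ∣ N[ G ] v ∩ D ∣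

-- γ_{×k}(G) ≤ m  (with γ = +∞ when no k-tuple dominating set exists):
-- some k-tuple dominating set has size at most m
γ×≤ : ∀ {n} → Graph n → ℕ → ℕ → Set
γ×≤ {n} G k m = Σ (Subset n) (λ D → IsKTupleDominating G k D × ∣ D ∣ ≤ m)

-- A vertex u ∈ C₁ can only miss vertices after it, and a vertex w ∈ C₂ only
-- vertices before it. If some v were missed by both u and w, column v of M*
-- would have zeros in rows u < v < w, so by consecutiveness also in row v,
-- contradicting the 1 on the diagonal. Hence every vertex dominates all of any
-- k vertices of C₁ or all of any k vertices of C₂, and their union, of size at
-- most 2k, is a k-tuple dominating set.
module Submission where

open import Defs
open import Data.Nat using (ℕ; _≤_; _*_; NonZero)
open import Data.Fin.Subset using (∣_∣)

open import Data.Bool using (Bool; true; false; not; T)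
open import Data.Bool.Properties using (T-≡; T-∧; T-∨)
open import Data.Empty using (⊥)
open import Data.Fin using (Fin; toℕ)
import Data.Fin.Properties as Fin
open import Data.Fin.Subset using (Subset; _∈_; _∉_; _⊆_; _∩_; _∪_; inside; outside)
  renaming (⊥ to ∅)
open import Data.Fin.Subset.Properties
  using (_∈?_; ⊆-min; ∣⊥∣≡0; s⊆s; p⊆q⇒∣p∣≤∣q∣; x∈p∩q⁺; p⊆p∪q; q⊆p∪q)
open import Data.List using (allFin)
open import Data.List.Membership.Propositional.Properties using (∈-allFin)
import Data.List.Relation.Unary.All as All
open import Data.List.Relation.Unary.All.Properties using (all⁺)
open import Data.Nat using (zero; suc; _+_; _<_; z≤n; s≤s)
import Data.Nat.Properties as ℕ
open import Data.Product using (∃; _×_; _,_; proj₂)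
open import Data.Sum using (_⊎_; inj₁; inj₂)
open import Data.Vec using (_∷_; []; tabulate)
open import Data.Vec.Properties using (lookup∘tabulate; lookup⇒[]=; []=⇒lookup)
open import Function using (_∘_; Equivalence)
open import Relation.Nullary using (¬_; yes; no)
open import Relation.Nullary.Decidable using (toWitness; decidable-stable; ¬?; _×-dec_)
open import Relation.Binary.PropositionalEquality using (_≡_; refl; sym; trans; cong; cong₂; subst)

T-not⇒¬T : ∀ {b} → T (not b) → ¬ T b
T-not⇒¬T {false} _ ()

¬T⇒T-not : ∀ {b} → ¬ T b → T (not b)
¬T⇒T-not {false} _ = _
¬T⇒T-not {true}  ¬t with () ← ¬t _

∈-tabulate⁺ : ∀ {n} (f : Fin n → Bool) {x} → T (f x) → x ∈ tabulate f
∈-tabulate⁺ f {x} fx =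
  lookup⇒[]= x (tabulate f) (trans (lookup∘tabulate f x) (Equivalence.to T-≡ fx))

∈-tabulate⁻ : ∀ {n} (f : Fin n → Bool) {x} → x ∈ tabulate f → T (f x)
∈-tabulate⁻ f {x} x∈ =
  Equivalence.from T-≡ (trans (sym (lookup∘tabulate f x)) ([]=⇒lookup x∈))

∣p∪q∣≤∣p∣+∣q∣ : ∀ {n} (p q : Subset n) → ∣ p ∪ q ∣ ≤ ∣ p ∣ + ∣ q ∣
∣p∪q∣≤∣p∣+∣q∣ []            []            = z≤n
∣p∪q∣≤∣p∣+∣q∣ (outside ∷ p) (outside ∷ q) = ∣p∪q∣≤∣p∣+∣q∣ p q
∣p∪q∣≤∣p∣+∣q∣ (inside  ∷ p) (outside ∷ q) = s≤s (∣p∪q∣≤∣p∣+∣q∣ p q)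
∣p∪q∣≤∣p∣+∣q∣ (outside ∷ p) (inside  ∷ q) =
  ℕ.≤-trans (s≤s (∣p∪q∣≤∣p∣+∣q∣ p q)) (ℕ.≤-reflexive (sym (ℕ.+-suc ∣ p ∣ ∣ q ∣)))
∣p∪q∣≤∣p∣+∣q∣ (inside  ∷ p) (inside  ∷ q) =
  s≤s (ℕ.≤-trans (∣p∪q∣≤∣p∣+∣q∣ p q) (ℕ.+-monoʳ-≤ ∣ p ∣ (ℕ.n≤1+n ∣ q ∣)))

∣p∣≤∣q∩r∣ : ∀ {n} {p q r : Subset n} → p ⊆ q → p ⊆ r → ∣ p ∣ ≤ ∣ q ∩ r ∣
∣p∣≤∣q∩r∣ p⊆q p⊆r = p⊆q⇒∣p∣≤∣q∣ (λ x∈p → x∈p∩q⁺ (p⊆q x∈p , p⊆r x∈p))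

subset-of-size : ∀ {n} k (p : Subset n) → k ≤ ∣ p ∣ → ∃ λ q → q ⊆ p × ∣ q ∣ ≡ k
subset-of-size {n} zero p _ = ∅ , ⊆-min p , ∣⊥∣≡0 n
subset-of-size (suc k) (inside ∷ p) (s≤s k≤∣p∣) with subset-of-size k p k≤∣p∣
... | q , q⊆p , ∣q∣≡k = inside ∷ q , s⊆s q⊆p , cong suc ∣q∣≡k
subset-of-size (suc k) (outside ∷ p) k<∣p∣ with subset-of-size (suc k) p k<∣p∣
... | q , q⊆p , ∣q∣≡k = outside ∷ q , s⊆s q⊆p , ∣q∣≡k

module _ {n} (G : Graph n) where

  M*-sym : ∀ u v → M* G u v ≡ M* G v u
  M*-sym u v with u Fin.≟ v | v Fin.≟ u
  ... | yes _   | yes _   = refl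
  ... | yes u≡v | no  v≢u with () ← v≢u (sym u≡v)
  ... | no  u≢v | yes v≡u with () ← u≢v (sym v≡u)
  ... | no  _   | no  _   = adj-sym G u v

  M*-refl : ∀ v → T (M* G v v)
  M*-refl v with v Fin.≟ v
  ... | yes _   = _
  ... | no  v≢v with () ← v≢v refl

  isZero-sym : ∀ u v → T (isZero G u v) → T (isZero G v u)
  isZero-sym u v = subst (T ∘ not) (M*-sym u v)

  ∉N[]⇒isZero : ∀ {u v} → u ∉ N[ G ] v → T (isZero G u v)
  ∉N[]⇒isZero u∉N = ¬T⇒T-not (λ uv → u∉N (∈-tabulate⁺ _ uv))

  C₁-isZero⇒< : ∀ {u v} → u ∈ C₁ G → T (isZero G u v) → toℕ u < toℕ v
  C₁-isZero⇒< {u} {v} u∈C₁ zero-uv with Equivalence.to T-∨ row-v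
    where
    zerosBelow-u : T (zerosBelow G u)
    zerosBelow-u = proj₂ (Equivalence.to T-∧ (∈-tabulate⁻ _ u∈C₁))
    row-v = All.lookup (all⁺ _ (allFin n) zerosBelow-u) (∈-allFin v)
  ... | inj₁ nonzero-vu with () ← T-not⇒¬T nonzero-vu (isZero-sym u v zero-uv)
  ... | inj₂ u<v = toWitness u<v

  C₂-isZero⇒> : ∀ {w v} → w ∈ C₂ G → T (isZero G w v) → toℕ v < toℕ w
  C₂-isZero⇒> {w} {v} w∈C₂ zero-wv with Equivalence.to T-∨ row-v
    where
    zerosAbove-w : T (zerosAbove G w)
    zerosAbove-w = proj₂ (Equivalence.to T-∧ (∈-tabulate⁻ _ w∈C₂))
    row-v = All.lookup (all⁺ _ (allFin n) zerosAbove-w) (∈-allFin v)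
  ... | inj₁ nonzero-vw with () ← T-not⇒¬T nonzero-vw (isZero-sym w v zero-wv)
  ... | inj₂ v<w = toWitness v<w

  module _ (c0p : IsC0POrdering G) where

    C₁-C₂-no-common-nonneighbour : ∀ {u w v} → u ∈ C₁ G → w ∈ C₂ G →
      T (isZero G u v) → T (isZero G w v) → ⊥
    C₁-C₂-no-common-nonneighbour {u} {w} {v} u∈C₁ w∈C₂ zero-uv zero-wv =
      T-not⇒¬T zero-vv (M*-refl v)
      where
      zero-vv : T (isZero G v v)
      zero-vv = c0p v u v w (ℕ.<⇒≤ (C₁-isZero⇒< u∈C₁ zero-uv))
                            (ℕ.<⇒≤ (C₂-isZero⇒> w∈C₂ zero-wv)) zero-uv zero-wv

    C₁-or-C₂-part-⊆-N[] : ∀ {A B} → A ⊆ C₁ G → B ⊆ C₂ G →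
      ∀ v → A ⊆ N[ G ] v ⊎ B ⊆ N[ G ] v
    C₁-or-C₂-part-⊆-N[] {A} {B} A⊆C₁ B⊆C₂ v
      with Fin.any? (λ u → (u ∈? A) ×-dec ¬? (u ∈? N[ G ] v))
    ... | no ∄u = inj₁ λ {u} u∈A →
      decidable-stable (u ∈? N[ G ] v) (λ u∉N → ∄u (u , u∈A , u∉N))
    ... | yes (u , u∈A , u∉N) = inj₂ λ {w} w∈B →
      decidable-stable (w ∈? N[ G ] v) λ w∉N →
        C₁-C₂-no-common-nonneighbour (A⊆C₁ u∈A) (B⊆C₂ w∈B)
          (∉N[]⇒isZero u∉N) (∉N[]⇒isZero w∉N)

lemma3 : ∀ {n} (G : Graph n) → IsC0POrdering G →
    ∀ (k : ℕ) → .{{_ : NonZero k}} →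
    k ≤ ∣ C₁ G ∣ → k ≤ ∣ C₂ G ∣ → γ×≤ G k (2 * k)
lemma3 G c0p k k≤∣C₁∣ k≤∣C₂∣
  with subset-of-size k (C₁ G) k≤∣C₁∣ | subset-of-size k (C₂ G) k≤∣C₂∣
... | A , A⊆C₁ , ∣A∣≡k | B , B⊆C₂ , ∣B∣≡k = A ∪ B , dominating , size
  where
  dominating : IsKTupleDominating G k (A ∪ B)
  dominating v with C₁-or-C₂-part-⊆-N[] G c0p A⊆C₁ B⊆C₂ v
  ... | inj₁ A⊆N = subst (_≤ _) ∣A∣≡k (∣p∣≤∣q∩r∣ A⊆N (p⊆p∪q B))
  ... | inj₂ B⊆N = subst (_≤ _) ∣B∣≡k (∣p∣≤∣q∩r∣ B⊆N (q⊆p∪q A B))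

  size : ∣ A ∪ B ∣ ≤ 2 * k
  size = begin
    ∣ A ∪ B ∣     ≤⟨ ∣p∪q∣≤∣p∣+∣q∣ A B ⟩
    ∣ A ∣ + ∣ B ∣ ≡⟨ cong₂ _+_ ∣A∣≡k ∣B∣≡k ⟩
    k + k         ≡⟨ cong (k +_) (sym (ℕ.+-identityʳ k)) ⟩
    2 * k         ∎
    where open ℕ.≤-Reasoning
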